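{- Let $n \ge d$ be positive integers with $d$ even, let $a_1 < \dots < a_d$ be elements of $[n]$, let $J = [a_1,a_2] \cup [a_3,a_4] \cup \dots \cup [a_{d-1},a_d]$, let $L \subset [d]$ and let $E = \{a_l : l \in L\}$. Then, as integer-valued functions on $[n]^d$, \[\sum_{\omega \in \{0,1\}^L} (-1)^{|\omega|}\, \mathbbm{1}_{([a_1+\omega_1, a_2-\omega_2] \cup [a_3+\omega_3,a_4-\omega_4]\cup \dots \cup [a_{d-1}+\omega_{d-1}, a_d-\omega_d])^d} = \mathbbm{1}_{V(E,J)}.\]
   Context: $[n]=\{1,\dots,n\}$; for integers $a,b$, $[a,b]=\{a,\dots,b\}$ (the empty set if $a>b$). For $\omega \in \{0,1\}^d$, $|\omega|$ is the number of coordinates equal to $1$; $\{0,1\}^L$ is the set of $\omega \in \{0,1\}^d$ with $\omega_i = 0$ for all $i \in [d]\setminus L$. $S^d = S\times\dots\times S \subset [n]^d$ and $\mathbbm{1}_X$ is the indicator function of $X \subset [n]^d$. For $E, J \subset [n]$, $V(E,J)$ is the set of $x=(x_1,\dots,x_d) \in [n]^d$ such that $E \subset \{x_1,\dots,x_d\} \subset J$. -}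

module Defs where

open import Data.Bool using (Bool; true; false; _∧_; _∨_; not; if_then_else_)
open import Data.Nat using (ℕ; zero; suc; _+_; _∸_; _≤ᵇ_; _≡ᵇ_)
open import Data.Fin using (Fin; zero; suc)
open import Data.Fin.Subset using (Subset; ∣_∣)
open import Data.Vec using (Vec; []; _∷_; lookup)
open import Data.List using (List; []; _∷_; _++_; map; filterᵇ; foldr)
open import Data.Integer using (ℤ; 0ℤ; 1ℤ; -_; _*_; _^_)
import Data.Integer as ℤ

allFinᵇ : ∀ {d} → (Fin d → Bool) → Bool
allFinᵇ {zero} p = true
allFinᵇ {suc d} p = p zero ∧ allFinᵇ (λ i → p (suc i))

anyFinᵇ : ∀ {d} → (Fin d → Bool) → Bool
anyFinᵇ {zero} p = false
anyFinᵇ {suc d} p = p zero ∨ anyFinᵇ (λ i → p (suc i))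

-- membership of x in [lo₁, hi₂] ∪ [lo₃, hi₄] ∪ … ∪ [lo_{d-1}, hi_d]
-- (indices 1-based in the paper; here Fin d is 0-based)
unionᵇ : ∀ {d} → (Fin d → ℕ) → (Fin d → ℕ) → ℕ → Bool
unionᵇ {zero} lo hi x = false
unionᵇ {suc zero} lo hi x = false
unionᵇ {suc (suc d)} lo hi x =
  ((lo zero ≤ᵇ x) ∧ (x ≤ᵇ hi (suc zero)))
  ∨ unionᵇ (λ i → lo (suc (suc i))) (λ i → hi (suc (suc i))) x

Jᵇ : ∀ {d} → (Fin d → ℕ) → ℕ → Bool
Jᵇ a = unionᵇ a a

cubeᵇ : ∀ {d} → (ℕ → Bool) → (Fin d → ℕ) → Bool
cubeᵇ S x = allFinᵇ (λ i → S (x i))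

-- x ∈ V(E,J) with E = {a_l : l ∈ L}: E ⊆ {x₁,…,x_d} ⊆ J
Vᵇ : ∀ {d} → (Fin d → ℕ) → Subset d → (Fin d → ℕ) → Bool
Vᵇ a L x =
  allFinᵇ (λ l → not (lookup L l) ∨ anyFinᵇ (λ i → x i ≡ᵇ a l))
  ∧ allFinᵇ (λ i → Jᵇ a (x i))

𝟙 : Bool → ℤ
𝟙 b = if b then 1ℤ else 0ℤ

bit : ∀ {d} → Subset d → Fin d → ℕ
bit ω i = if lookup ω i then 1 else 0

allSubsets : ∀ d → List (Subset d)
allSubsets zero = [] ∷ []
allSubsets (suc d) = map (true ∷_) (allSubsets d) ++ map (false ∷_) (allSubsets d)

-- ω ∈ {0,1}^L : ω_i = 0 for i ∉ L
inCubeLᵇ : ∀ {d} → Subset d → Subset d → Bool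
inCubeLᵇ L ω = allFinᵇ (λ i → not (lookup ω i) ∨ lookup L i)

sumℤ : List ℤ → ℤ
sumℤ = foldr ℤ._+_ 0ℤ

lhs : ∀ {d} → (Fin d → ℕ) → Subset d → (Fin d → ℕ) → ℤ
lhs {d} a L x = sumℤ (map term (filterᵇ (inCubeLᵇ L) (allSubsets d)))
  where
  term : Subset d → ℤ
  term ω = ((- 1ℤ) ^ ∣ ω ∣) *
           𝟙 (cubeᵇ (unionᵇ (λ i → a i + bit ω i) (λ i → a i ∸ bit ω i)) x)

-- A point y lies in the shrunken union [a₁+ω₁, a₂-ω₂] ∪ … exactly when y ∈ J and y avoids the
-- endpoints {a_l : ω_l = 1}; this needs the a_l strictly increasing. Hence the shrunken cube
-- is J^d minus the points hitting some a_l with l ∈ ω, and the alternating sum over ω ⊆ L is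
-- inclusion–exclusion: it equals 1 exactly when x ∈ J^d and every a_l with l ∈ L is hit.
module Submission where

open import Defs
open import Data.Nat using (ℕ; _≤_; _<_)
open import Data.Nat.Divisibility using (_∣_)
open import Data.Fin using (Fin)
import Data.Fin as F
open import Data.Fin.Subset using (Subset)
open import Data.Product using (_×_)
open import Relation.Binary.PropositionalEquality using (_≡_)

open import Data.Nat using (zero; suc; _+_; _∸_; _≤ᵇ_; _≡ᵇ_; z≤n; s≤s; _≤?_)
import Data.Nat.Properties as ℕP
open import Data.Fin using (zero; suc)
open import Data.Bool using (Bool; true; false; _∧_; _∨_; not; if_then_else_; T)
open import Data.Bool.Properties using (∧-zeroʳ; ∧-identityʳ; ∨-identityʳ)
open import Data.Vec using (_∷_; lookup)
open import Data.List using ([]; _∷_; _++_; map; filterᵇ)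
import Data.List.Properties as ListP
open import Data.Integer using (ℤ; 0ℤ; 1ℤ; -_; _^_)
import Data.Integer as ℤ
import Data.Integer.Properties as ℤP
open import Data.Fin.Subset using (∣_∣)
open import Relation.Binary.PropositionalEquality using (refl; sym; trans; cong; cong₂; module ≡-Reasoning)
open import Relation.Binary.Definitions using (tri<; tri≈; tri>)
open import Relation.Binary.Core using (_Preserves_⟶_)
open import Relation.Nullary using (¬_; yes; no)
open import Data.Empty using (⊥-elim)

bitℕ : Bool → ℕ
bitℕ b = if b then 1 else 0

T⇒≡true : ∀ {b} → T b → b ≡ true
T⇒≡true {true} _ = refl

¬T⇒≡false : ∀ {b} → ¬ T b → b ≡ false
¬T⇒≡false {true} ¬t = ⊥-elim (¬t _)
¬T⇒≡false {false} _ = refl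

≤⇒≤ᵇ≡true : ∀ {m n} → m ≤ n → (m ≤ᵇ n) ≡ true
≤⇒≤ᵇ≡true m≤n = T⇒≡true (ℕP.≤⇒≤ᵇ m≤n)

>⇒≤ᵇ≡false : ∀ {m n} → n < m → (m ≤ᵇ n) ≡ false
>⇒≤ᵇ≡false {m} {n} n<m = ¬T⇒≡false (λ t → ℕP.<⇒≱ n<m (ℕP.≤ᵇ⇒≤ m n t))

≢⇒≡ᵇ≡false : ∀ {m n} → ¬ m ≡ n → (m ≡ᵇ n) ≡ false
≢⇒≡ᵇ≡false {m} {n} m≢n = ¬T⇒≡false (λ t → m≢n (ℕP.≡ᵇ⇒≡ m n t))

≡ᵇ-refl : ∀ m → (m ≡ᵇ m) ≡ true
≡ᵇ-refl m = T⇒≡true (ℕP.≡⇒≡ᵇ m m refl)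

≤ᵇ-punctureˡ : ∀ a y → (suc a ≤ᵇ y) ≡ (a ≤ᵇ y) ∧ not (y ≡ᵇ a)
≤ᵇ-punctureˡ a y with ℕP.<-cmp y a
... | tri< y<a _ _ rewrite >⇒≤ᵇ≡false (ℕP.m<n⇒m<1+n y<a) | >⇒≤ᵇ≡false y<a = refl
... | tri≈ _ refl _ rewrite >⇒≤ᵇ≡false (ℕP.n<1+n a) | ≤⇒≤ᵇ≡true (ℕP.≤-refl {a}) | ≡ᵇ-refl a = refl
... | tri> _ y≢a a<y rewrite ≤⇒≤ᵇ≡true a<y | ≤⇒≤ᵇ≡true (ℕP.<⇒≤ a<y) | ≢⇒≡ᵇ≡false y≢a = refl

≤ᵇ-punctureʳ : ∀ a y → (y ≤ᵇ a) ≡ (y ≤ᵇ suc a) ∧ not (y ≡ᵇ suc a)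
≤ᵇ-punctureʳ a y with ℕP.<-cmp y (suc a)
... | tri< (s≤s y≤a) y≢1+a _ rewrite ≤⇒≤ᵇ≡true y≤a | ≤⇒≤ᵇ≡true (ℕP.m≤n⇒m≤1+n y≤a) | ≢⇒≡ᵇ≡false y≢1+a = refl
... | tri≈ _ refl _ rewrite >⇒≤ᵇ≡false (ℕP.n<1+n a) | ≤⇒≤ᵇ≡true (ℕP.≤-refl {suc a}) | ≡ᵇ-refl a = refl
... | tri> _ _ 1+a<y rewrite >⇒≤ᵇ≡false (ℕP.<-trans (ℕP.n<1+n a) 1+a<y) | >⇒≤ᵇ≡false 1+a<y = refl

avoidᵇ : Bool → ℕ → ℕ → Bool
avoidᵇ b a y = not (b ∧ (y ≡ᵇ a))

lower-shift : ∀ b a y → (a + bitℕ b ≤ᵇ y) ≡ (a ≤ᵇ y) ∧ avoidᵇ b a y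
lower-shift false a y rewrite ℕP.+-identityʳ a = sym (∧-identityʳ _)
lower-shift true a y rewrite ℕP.+-comm a 1 = ≤ᵇ-punctureˡ a y

upper-shift : ∀ b a y → 0 < a → (y ≤ᵇ a ∸ bitℕ b) ≡ (y ≤ᵇ a) ∧ avoidᵇ b a y
upper-shift false a y _ = sym (∧-identityʳ _)
upper-shift true (suc a) y _ = ≤ᵇ-punctureʳ a y

∧-interchange : ∀ p q r s → (p ∧ q) ∧ (r ∧ s) ≡ (p ∧ r) ∧ (q ∧ s)
∧-interchange true true r s = refl
∧-interchange true false r s = sym (∧-zeroʳ r)
∧-interchange false q r s = refl

interval-shift : ∀ b₀ b₁ a₀ a₁ y → 0 < a₁ →
  (a₀ + bitℕ b₀ ≤ᵇ y) ∧ (y ≤ᵇ a₁ ∸ bitℕ b₁)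
    ≡ ((a₀ ≤ᵇ y) ∧ (y ≤ᵇ a₁)) ∧ (avoidᵇ b₀ a₀ y ∧ avoidᵇ b₁ a₁ y)
interval-shift b₀ b₁ a₀ a₁ y 0<a₁
  rewrite lower-shift b₀ a₀ y | upper-shift b₁ a₁ y 0<a₁ =
    ∧-interchange (a₀ ≤ᵇ y) (avoidᵇ b₀ a₀ y) (y ≤ᵇ a₁) (avoidᵇ b₁ a₁ y)

avoidsᵇ : ∀ {d} → Subset d → (Fin d → ℕ) → ℕ → Bool
avoidsᵇ ω a y = allFinᵇ (λ l → avoidᵇ (lookup ω l) (a l) y)

allFinᵇ-true : ∀ {d} (p : Fin d → Bool) → (∀ i → p i ≡ true) → allFinᵇ p ≡ true
allFinᵇ-true {zero} p _ = refl
allFinᵇ-true {suc d} p h rewrite h zero = allFinᵇ-true (λ i → p (suc i)) (λ i → h (suc i))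

avoidᵇ-≢ : ∀ b {a y} → ¬ y ≡ a → avoidᵇ b a y ≡ true
avoidᵇ-≢ b y≢a rewrite ≢⇒≡ᵇ≡false y≢a | ∧-zeroʳ b = refl

avoidsᵇ-below : ∀ {d} (ω : Subset d) (a : Fin d → ℕ) {y} → (∀ l → y < a l) → avoidsᵇ ω a y ≡ true
avoidsᵇ-below ω a y<a = allFinᵇ-true _ (λ l → avoidᵇ-≢ (lookup ω l) (ℕP.<⇒≢ (y<a l)))

unionᵇ-below : ∀ {d} (lo hi : Fin d → ℕ) {y} → (∀ i → y < lo i) → unionᵇ lo hi y ≡ false
unionᵇ-below {zero} lo hi _ = refl
unionᵇ-below {suc zero} lo hi _ = refl
unionᵇ-below {suc (suc d)} lo hi y<lo rewrite >⇒≤ᵇ≡false (y<lo zero) =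
  unionᵇ-below (λ i → lo (suc (suc i))) (λ i → hi (suc (suc i))) (λ i → y<lo (suc (suc i)))

unionᵇ-cons : ∀ b₀ b₁ a₀ a₁ y (J′ A′ : Bool) → a₀ < a₁ →
  (y ≤ a₁ → J′ ≡ false) → (y ≤ a₁ → A′ ≡ true) →
  (((a₀ ≤ᵇ y) ∧ (y ≤ᵇ a₁)) ∧ (avoidᵇ b₀ a₀ y ∧ avoidᵇ b₁ a₁ y)) ∨ (J′ ∧ A′)
    ≡ (((a₀ ≤ᵇ y) ∧ (y ≤ᵇ a₁)) ∨ J′) ∧ (avoidᵇ b₀ a₀ y ∧ (avoidᵇ b₁ a₁ y ∧ A′))
unionᵇ-cons b₀ b₁ a₀ a₁ y J′ A′ a₀<a₁ J′≡false A′≡true with y ≤? a₁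
... | yes y≤a₁
  rewrite J′≡false y≤a₁ | A′≡true y≤a₁
        | ∨-identityʳ (((a₀ ≤ᵇ y) ∧ (y ≤ᵇ a₁)) ∧ (avoidᵇ b₀ a₀ y ∧ avoidᵇ b₁ a₁ y))
        | ∨-identityʳ ((a₀ ≤ᵇ y) ∧ (y ≤ᵇ a₁))
        | ∧-identityʳ (avoidᵇ b₁ a₁ y) = refl
... | no y≰a₁
  rewrite >⇒≤ᵇ≡false (ℕP.≰⇒> y≰a₁) | ∧-zeroʳ (a₀ ≤ᵇ y)
        | avoidᵇ-≢ b₀ (ℕP.>⇒≢ (ℕP.<-trans a₀<a₁ (ℕP.≰⇒> y≰a₁)))
        | avoidᵇ-≢ b₁ (ℕP.>⇒≢ (ℕP.≰⇒> y≰a₁)) = refl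

unionᵇ-shrink : ∀ {d} (a : Fin d → ℕ) → a Preserves F._<_ ⟶ _<_ → ∀ ω y →
  unionᵇ (λ i → a i + bit ω i) (λ i → a i ∸ bit ω i) y ≡ Jᵇ a y ∧ avoidsᵇ ω a y
unionᵇ-shrink {zero} a _ ω y = refl
unionᵇ-shrink {suc zero} a _ ω y = refl
unionᵇ-shrink {suc (suc d)} a a↑ (b₀ ∷ b₁ ∷ ω) y
  rewrite unionᵇ-shrink (λ i → a (suc (suc i))) (λ i<j → a↑ (s≤s (s≤s i<j))) ω y
        | interval-shift b₀ b₁ (a zero) (a (suc zero)) y (ℕP.≤-<-trans z≤n (a↑ (s≤s z≤n))) =
  unionᵇ-cons b₀ b₁ (a zero) (a (suc zero)) y (Jᵇ a₊₂ y) (avoidsᵇ ω a₊₂ y) a₀<a₁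
    (λ y≤a₁ → unionᵇ-below a₊₂ a₊₂ (beyond y≤a₁))
    (λ y≤a₁ → avoidsᵇ-below ω a₊₂ (beyond y≤a₁))
  where
  a₊₂ : Fin d → ℕ
  a₊₂ i = a (suc (suc i))
  a₀<a₁ : a zero < a (suc zero)
  a₀<a₁ = a↑ (s≤s z≤n)
  beyond : y ≤ a (suc zero) → ∀ i → y < a₊₂ i
  beyond y≤a₁ i = ℕP.≤-<-trans y≤a₁ (a↑ (s≤s (s≤s z≤n)))

allFinᵇ-cong : ∀ {d} {p q : Fin d → Bool} → (∀ i → p i ≡ q i) → allFinᵇ p ≡ allFinᵇ q
allFinᵇ-cong {zero} _ = refl
allFinᵇ-cong {suc d} p≗q = cong₂ _∧_ (p≗q zero) (allFinᵇ-cong (λ i → p≗q (suc i)))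

allFinᵇ-∧ : ∀ {d} (p q : Fin d → Bool) → allFinᵇ (λ i → p i ∧ q i) ≡ allFinᵇ p ∧ allFinᵇ q
allFinᵇ-∧ {zero} p q = refl
allFinᵇ-∧ {suc d} p q rewrite allFinᵇ-∧ (λ i → p (suc i)) (λ i → q (suc i)) =
  ∧-interchange (p zero) (q zero) (allFinᵇ (λ i → p (suc i))) (allFinᵇ (λ i → q (suc i)))

allFinᵇ-comm : ∀ {d e} (p : Fin d → Fin e → Bool) →
  allFinᵇ (λ i → allFinᵇ (λ j → p i j)) ≡ allFinᵇ (λ j → allFinᵇ (λ i → p i j))
allFinᵇ-comm {zero} {e} p = sym (allFinᵇ-true {e} _ (λ _ → refl))
allFinᵇ-comm {suc d} p =
  trans (cong (allFinᵇ (p zero) ∧_) (allFinᵇ-comm (λ i → p (suc i))))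
        (sym (allFinᵇ-∧ (p zero) (λ j → allFinᵇ (λ i → p (suc i) j))))

allFinᵇ-not-∧ : ∀ {d} b (p : Fin d → Bool) → allFinᵇ (λ i → not (b ∧ p i)) ≡ not (b ∧ anyFinᵇ p)
allFinᵇ-not-∧ {zero} true p = refl
allFinᵇ-not-∧ {zero} false p = refl
allFinᵇ-not-∧ {suc d} false p = allFinᵇ-true {d} _ (λ _ → refl)
allFinᵇ-not-∧ {suc d} true p rewrite allFinᵇ-not-∧ true (λ i → p (suc i)) with p zero
... | true = refl
... | false = refl

hitsᵇ : ∀ {d} → (Fin d → ℕ) → ℕ → Bool
hitsᵇ x c = anyFinᵇ (λ i → x i ≡ᵇ c)

disjointᵇ : ∀ {d} → Subset d → (Fin d → Bool) → Bool
disjointᵇ ω T = allFinᵇ (λ l → not (lookup ω l ∧ T l))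

cubeᵇ-shrink : ∀ {d} (a : Fin d → ℕ) → a Preserves F._<_ ⟶ _<_ → ∀ ω (x : Fin d → ℕ) →
  cubeᵇ (unionᵇ (λ i → a i + bit ω i) (λ i → a i ∸ bit ω i)) x
    ≡ cubeᵇ (Jᵇ a) x ∧ disjointᵇ ω (λ l → hitsᵇ x (a l))
cubeᵇ-shrink a a↑ ω x = begin
  allFinᵇ (λ i → unionᵇ (λ j → a j + bit ω j) (λ j → a j ∸ bit ω j) (x i))
    ≡⟨ allFinᵇ-cong (λ i → unionᵇ-shrink a a↑ ω (x i)) ⟩
  allFinᵇ (λ i → Jᵇ a (x i) ∧ avoidsᵇ ω a (x i))
    ≡⟨ allFinᵇ-∧ (λ i → Jᵇ a (x i)) (λ i → avoidsᵇ ω a (x i)) ⟩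
  cubeᵇ (Jᵇ a) x ∧ allFinᵇ (λ i → avoidsᵇ ω a (x i))
    ≡⟨ cong (cubeᵇ (Jᵇ a) x ∧_) (allFinᵇ-comm (λ i l → avoidᵇ (lookup ω l) (a l) (x i))) ⟩
  cubeᵇ (Jᵇ a) x ∧ allFinᵇ (λ l → allFinᵇ (λ i → avoidᵇ (lookup ω l) (a l) (x i)))
    ≡⟨ cong (cubeᵇ (Jᵇ a) x ∧_) (allFinᵇ-cong (λ l → allFinᵇ-not-∧ (lookup ω l) (λ i → x i ≡ᵇ a l))) ⟩
  cubeᵇ (Jᵇ a) x ∧ disjointᵇ ω (λ l → hitsᵇ x (a l)) ∎
  where open ≡-Reasoning

sumℤ-++ : ∀ xs ys → sumℤ (xs ++ ys) ≡ sumℤ xs ℤ.+ sumℤ ys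
sumℤ-++ [] ys = sym (ℤP.+-identityˡ _)
sumℤ-++ (x ∷ xs) ys = trans (cong (ℤ._+_ x) (sumℤ-++ xs ys)) (sym (ℤP.+-assoc x _ _))

sumℤ-filterᵇ : ∀ {A : Set} (p : A → Bool) (f : A → ℤ) xs →
  sumℤ (map f (filterᵇ p xs)) ≡ sumℤ (map (λ x → if p x then f x else 0ℤ) xs)
sumℤ-filterᵇ p f [] = refl
sumℤ-filterᵇ p f (x ∷ xs) with p x
... | true = cong (ℤ._+_ (f x)) (sumℤ-filterᵇ p f xs)
... | false = trans (sumℤ-filterᵇ p f xs) (sym (ℤP.+-identityˡ _))

sumℤ-zero : ∀ {A : Set} (f : A → ℤ) → (∀ x → f x ≡ 0ℤ) → ∀ xs → sumℤ (map f xs) ≡ 0ℤ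
sumℤ-zero f f≗0 [] = refl
sumℤ-zero f f≗0 (x ∷ xs) rewrite f≗0 x | sumℤ-zero f f≗0 xs = refl

sumℤ-neg : ∀ {A : Set} (f : A → ℤ) xs → sumℤ (map (λ x → - f x) xs) ≡ - sumℤ (map f xs)
sumℤ-neg f [] = refl
sumℤ-neg f (x ∷ xs) = trans (cong (ℤ._+_ (- f x)) (sumℤ-neg f xs)) (sym (ℤP.neg-distrib-+ (f x) _))

sumℤ-allSubsets-suc : ∀ d (f : Subset (suc d) → ℤ) →
  sumℤ (map f (allSubsets (suc d)))
    ≡ sumℤ (map (λ ω → f (true ∷ ω)) (allSubsets d)) ℤ.+ sumℤ (map (λ ω → f (false ∷ ω)) (allSubsets d))
sumℤ-allSubsets-suc d f = begin
  sumℤ (map f (map (true ∷_) (allSubsets d) ++ map (false ∷_) (allSubsets d)))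
    ≡⟨ cong sumℤ (ListP.map-++ f (map (true ∷_) (allSubsets d)) (map (false ∷_) (allSubsets d))) ⟩
  sumℤ (map f (map (true ∷_) (allSubsets d)) ++ map f (map (false ∷_) (allSubsets d)))
    ≡⟨ sumℤ-++ (map f (map (true ∷_) (allSubsets d))) (map f (map (false ∷_) (allSubsets d))) ⟩
  sumℤ (map f (map (true ∷_) (allSubsets d))) ℤ.+ sumℤ (map f (map (false ∷_) (allSubsets d)))
    ≡⟨ sym (cong₂ (λ s t → sumℤ s ℤ.+ sumℤ t) (ListP.map-∘ (allSubsets d)) (ListP.map-∘ (allSubsets d))) ⟩
  sumℤ (map (λ ω → f (true ∷ ω)) (allSubsets d)) ℤ.+ sumℤ (map (λ ω → f (false ∷ ω)) (allSubsets d)) ∎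
  where open ≡-Reasoning

sign : ∀ {d} → Subset d → ℤ
sign ω = (- 1ℤ) ^ ∣ ω ∣

_⊆ᵇ_ : ∀ {d} → Subset d → (Fin d → Bool) → Bool
L ⊆ᵇ T = allFinᵇ (λ l → not (lookup L l) ∨ T l)

signedTerm : ∀ {d} → Subset d → (Fin d → Bool) → Subset d → ℤ
signedTerm L T ω = if inCubeLᵇ L ω then sign ω ℤ.* 𝟙 (disjointᵇ ω T) else 0ℤ

signedTerm-hit : ∀ {d} (L : Subset d) (T : Fin (suc d) → Bool) → T zero ≡ true →
  ∀ ω → signedTerm (true ∷ L) T (true ∷ ω) ≡ 0ℤ
signedTerm-hit L T T₀≡true ω rewrite T₀≡true with inCubeLᵇ L ω
... | true = ℤP.*-zeroʳ (sign (true ∷ ω))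
... | false = refl

signedTerm-miss : ∀ {d} (L : Subset d) (T : Fin (suc d) → Bool) → T zero ≡ false →
  ∀ ω → signedTerm (true ∷ L) T (true ∷ ω) ≡ - signedTerm L (λ i → T (suc i)) ω
signedTerm-miss L T T₀≡false ω rewrite T₀≡false with inCubeLᵇ L ω
... | true = trans (ℤP.*-assoc (- 1ℤ) (sign ω) _) (ℤP.-1*i≡-i _)
... | false = refl

inclusion–exclusion : ∀ {d} (L : Subset d) (T : Fin d → Bool) →
  sumℤ (map (signedTerm L T) (allSubsets d)) ≡ 𝟙 (L ⊆ᵇ T)
inclusion–exclusion {zero} L T = refl
inclusion–exclusion {suc d} (false ∷ L) T =
  trans (sumℤ-allSubsets-suc d (signedTerm (false ∷ L) T))
  (trans (cong (ℤ._+ sumℤ (map (signedTerm L T₊) (allSubsets d))) (sumℤ-zero _ (λ _ → refl) (allSubsets d)))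
  (trans (ℤP.+-identityˡ _) (inclusion–exclusion L T₊)))
  where
  T₊ : Fin d → Bool
  T₊ i = T (suc i)
inclusion–exclusion {suc d} (true ∷ L) T = by-first-point (T zero) refl
  where
  T₊ : Fin d → Bool
  T₊ i = T (suc i)
  S : ℤ
  S = sumℤ (map (signedTerm L T₊) (allSubsets d))
  by-first-point : ∀ t → T zero ≡ t →
    sumℤ (map (signedTerm (true ∷ L) T) (allSubsets (suc d))) ≡ 𝟙 (t ∧ (L ⊆ᵇ T₊))
  by-first-point true T₀≡true =
    trans (sumℤ-allSubsets-suc d (signedTerm (true ∷ L) T))
    (trans (cong (ℤ._+ S) (sumℤ-zero _ (signedTerm-hit L T T₀≡true) (allSubsets d)))
    (trans (ℤP.+-identityˡ S) (inclusion–exclusion L T₊)))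
  by-first-point false T₀≡false =
    trans (sumℤ-allSubsets-suc d (signedTerm (true ∷ L) T))
    (trans (cong (ℤ._+ S) (trans (cong sumℤ (ListP.map-cong (signedTerm-miss L T T₀≡false) (allSubsets d)))
                                 (sumℤ-neg (signedTerm L T₊) (allSubsets d))))
    (ℤP.+-inverseˡ S))

inclusion–exclusion-∧ : ∀ {d} (L : Subset d) (T : Fin d → Bool) c →
  sumℤ (map (λ ω → if inCubeLᵇ L ω then sign ω ℤ.* 𝟙 (c ∧ disjointᵇ ω T) else 0ℤ) (allSubsets d))
    ≡ 𝟙 ((L ⊆ᵇ T) ∧ c)
inclusion–exclusion-∧ L T true = trans (inclusion–exclusion L T) (cong 𝟙 (sym (∧-identityʳ (L ⊆ᵇ T))))
inclusion–exclusion-∧ {d} L T false =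
  trans (sumℤ-zero _ vanishes (allSubsets d)) (cong 𝟙 (sym (∧-zeroʳ (L ⊆ᵇ T))))
  where
  vanishes : ∀ ω → (if inCubeLᵇ L ω then sign ω ℤ.* 0ℤ else 0ℤ) ≡ 0ℤ
  vanishes ω with inCubeLᵇ L ω
  ... | true = ℤP.*-zeroʳ (sign ω)
  ... | false = refl

lemma3p4 : (n d : ℕ) → 1 ≤ d → d ≤ n → 2 ∣ d →
           (a : Fin d → ℕ) → (∀ i → 1 ≤ a i × a i ≤ n) →
           (∀ i j → i F.< j → a i < a j) →
           (L : Subset d) →
           (x : Fin d → ℕ) → (∀ i → 1 ≤ x i × x i ≤ n) →
           lhs a L x ≡ 𝟙 (Vᵇ a L x)
lemma3p4 n d _ _ _ a _ a↑ L x _ = begin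
  lhs a L x
    ≡⟨ sumℤ-filterᵇ (inCubeLᵇ L) _ (allSubsets d) ⟩
  sumℤ (map (λ ω → if inCubeLᵇ L ω then sign ω ℤ.* 𝟙 (shrunkCube ω) else 0ℤ) (allSubsets d))
    ≡⟨ cong sumℤ (ListP.map-cong (λ ω → cong (λ b → if inCubeLᵇ L ω then sign ω ℤ.* 𝟙 b else 0ℤ)
                                             (cubeᵇ-shrink a (λ {i} {j} → a↑ i j) ω x))
                                 (allSubsets d)) ⟩
  sumℤ (map (λ ω → if inCubeLᵇ L ω then sign ω ℤ.* 𝟙 (cubeᵇ (Jᵇ a) x ∧ disjointᵇ ω hit) else 0ℤ)
            (allSubsets d))
    ≡⟨ inclusion–exclusion-∧ L hit (cubeᵇ (Jᵇ a) x) ⟩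
  𝟙 (Vᵇ a L x) ∎
  where
  open ≡-Reasoning
  shrunkCube : Subset d → Bool
  shrunkCube ω = cubeᵇ (unionᵇ (λ i → a i + bit ω i) (λ i → a i ∸ bit ω i)) x
  hit : Fin d → Bool
  hit l = hitsᵇ x (a l)
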